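{- Let $V=\{1,\ldots,v\}$, $t\ge 0$, and let $\{T_0,T_1\}$ be a $[t]$-trade over $V$. For every $w\in 2^V$, the pair $\{T_0+w,\,T_1+w\}$, where $T_j+w=\{x+w: x\in T_j\}$ and $+$ is addition in $\mathbb F_2^v$ (i.e., symmetric difference of subsets), is also a $[t]$-trade.
   Context: Subsets of $V$ are identified with their characteristic vectors, so $2^V$ is the vector space $\mathbb F_2^v$. A $[t]$-trade is a pair $\{T_0,T_1\}$ of disjoint subsets of $2^V$ such that for every $i\in\{0,\ldots,t\}$ and every $i$-element subset $s\subseteq V$, the number of elements of $T_0$ containing $s$ equals the number of elements of $T_1$ containing $s$. -}

module Defs where

open import Data.Nat using (ℕ; zero; suc; _≤_)
open import Data.Bool using (Bool; true; false; _xor_; T)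
open import Data.Bool.Properties using (T?)
open import Data.Vec using (Vec; []; _∷_; zipWith)
open import Data.List using (List; []; _∷_; map; _++_; filter; length)
open import Data.Fin.Subset using (Subset; _⊆_; ∣_∣)
open import Data.Fin.Subset.Properties using (_⊆?_)
open import Data.Product using (_×_)
open import Relation.Nullary using (¬_)
open import Relation.Binary.PropositionalEquality using (_≡_)
open import Relation.Nullary.Decidable using (_×-dec_)

-- All 2^v subsets of V = Fin v, each listed exactly once.
allSubsets : (v : ℕ) → List (Subset v)
allSubsets zero    = [] ∷ []
allSubsets (suc v) = map (false ∷_) (allSubsets v) ++ map (true ∷_) (allSubsets v)

Family : ℕ → Set
Family v = Subset v → Bool

_+ᵥ_ : ∀ {v} → Subset v → Subset v → Subset v
x +ᵥ w = zipWith _xor_ x w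

-- T + w = { x + w : x ∈ T }; since +w is an involution, y ∈ T + w iff y + w ∈ T.
_+ᶠ_ : ∀ {v} → Family v → Subset v → Family v
(F +ᶠ w) y = F (y +ᵥ w)

countContaining : ∀ {v} → Family v → Subset v → ℕ
countContaining {v} F s =
  length (filter (λ x → T? (F x) ×-dec (s ⊆? x)) (allSubsets v))

Disjoint : ∀ {v} → Family v → Family v → Set
Disjoint {v} F G = (x : Subset v) → ¬ (T (F x) × T (G x))

IsTrade : ∀ {v} → ℕ → Family v → Family v → Set
IsTrade {v} t T₀ T₁ =
  Disjoint T₀ T₁ ×
  ((s : Subset v) → ∣ s ∣ ≤ t → countContaining T₀ s ≡ countContaining T₁ s)

module Submission where

-- Replace a family of sets by its weight function W : 2^V → ℕ and
-- write  containing W s  for the total weight of the sets x ⊇ s.  Splitting the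
-- cube 2^(1+v) along its first coordinate gives a recursion for  containing :
-- a set s ∋ 1 only sees the upper half  high W , a set s ∌ 1 sees the sum of both
-- halves  low W ⊕ high W .  Two weights are t-balanced if they agree on
-- containing s for all |s| ≤ t; balance then passes to the two halves (at level
-- t - 1) and to their sum (at level t).  Translating by w = (b ∷ w') either keeps
-- the halves (b = 0) or swaps them (b = 1), each half being translated by w'.
-- Hence, by induction on the dimension, translation preserves t-balance
-- (balanced-shift).  The theorem follows by reading a trade as a balanced pair
-- of 0/1 weights (countContaining≡containing); disjointness is preserved since
-- x ↦ x + w is applied to both families at once.

open import Defs
open import Data.Nat using (ℕ; zero; suc; _+_; _≤_; s≤s)
open import Data.Nat.Properties using (+-comm; +-cancelʳ-≡; m≤n⇒m≤1+n; +-commutativeSemigroup)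
open import Algebra.Properties.CommutativeSemigroup +-commutativeSemigroup using (interchange)
open import Data.Bool using (true; false; T; if_then_else_)
open import Data.Bool.Properties using (T?; ∧-zeroʳ)
open import Data.Vec using (_∷_; [])
open import Data.List using (List; []; _∷_; map; _++_; filter; length)
open import Data.List.Properties using (filter-++; length-++)
open import Data.Fin.Subset using (Subset; _⊆_; ∣_∣)
open import Data.Fin.Subset.Properties using (_⊆?_)
open import Data.Product using (_×_; _,_)
open import Relation.Nullary using (does)
open import Relation.Nullary.Decidable using (_×-dec_)
open import Relation.Unary using (Pred; Decidable)
open import Relation.Binary.PropositionalEquality
open ≡-Reasoning

length-filter-map : ∀ {ℓ} {A B : Set} {P : Pred B ℓ} (P? : Decidable P) (f : A → B) (xs : List A) →
  length (filter P? (map f xs)) ≡ length (filter (λ x → P? (f x)) xs)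
length-filter-map P? f [] = refl
length-filter-map P? f (x ∷ xs) with does (P? (f x))
... | true  = cong suc (length-filter-map P? f xs)
... | false = length-filter-map P? f xs

length-filter-does : ∀ {ℓ ℓ′} {A : Set} {P : Pred A ℓ} {Q : Pred A ℓ′} (P? : Decidable P) (Q? : Decidable Q) →
  (∀ x → does (P? x) ≡ does (Q? x)) → (xs : List A) → length (filter P? xs) ≡ length (filter Q? xs)
length-filter-does P? Q? same [] = refl
length-filter-does P? Q? same (x ∷ xs) with does (P? x) | does (Q? x) | same x
... | true  | .true  | refl = cong suc (length-filter-does P? Q? same xs)
... | false | .false | refl = length-filter-does P? Q? same xs

length-filter-none : ∀ {ℓ} {A : Set} {P : Pred A ℓ} (P? : Decidable P) →
  (∀ x → does (P? x) ≡ false) → (xs : List A) → length (filter P? xs) ≡ 0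
length-filter-none P? none [] = refl
length-filter-none P? none (x ∷ xs) with does (P? x) | none x
... | .false | refl = length-filter-none P? none xs

-- Weights on the cube 2^V; a family is the special case of a 0/1 weight.

Weight : ℕ → Set
Weight v = Subset v → ℕ

_⊕_ : ∀ {v} → Weight v → Weight v → Weight v
(W ⊕ W′) x = W x + W′ x

low high : ∀ {v} → Weight (suc v) → Weight v
low  W x = W (false ∷ x)
high W x = W (true ∷ x)

-- Translation by w: (W ↑ w) x = W (x + w).  For families,  indicator (F +ᶠ w)
-- is definitionally  indicator F ↑ w .
_↑_ : ∀ {v} → Weight v → Subset v → Weight v
(W ↑ w) x = W (x +ᵥ w)

indicator : ∀ {v} → Family v → Weight v
indicator F x = if F x then 1 else 0

containing : ∀ {v} → Weight v → Subset v → ℕ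
containing {zero}  W []          = W []
containing {suc v} W (true  ∷ s) = containing (high W) s
containing {suc v} W (false ∷ s) = containing (low W ⊕ high W) s

containing-⊕ : ∀ {v} (W W′ : Weight v) (s : Subset v) →
  containing (W ⊕ W′) s ≡ containing W s + containing W′ s
containing-⊕ {zero}  W W′ []          = refl
containing-⊕ {suc v} W W′ (true  ∷ s) = containing-⊕ (high W) (high W′) s
containing-⊕ {suc v} W W′ (false ∷ s) = begin
  containing ((low W ⊕ low W′) ⊕ (high W ⊕ high W′)) s
    ≡⟨ containing-⊕ (low W ⊕ low W′) (high W ⊕ high W′) s ⟩
  containing (low W ⊕ low W′) s + containing (high W ⊕ high W′) s
    ≡⟨ cong₂ _+_ (containing-⊕ (low W) (low W′) s) (containing-⊕ (high W) (high W′) s) ⟩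
  (containing (low W) s + containing (low W′) s) + (containing (high W) s + containing (high W′) s)
    ≡⟨ interchange (containing (low W) s) _ _ _ ⟩
  (containing (low W) s + containing (high W) s) + (containing (low W′) s + containing (high W′) s)
    ≡⟨ sym (cong₂ _+_ (containing-⊕ (low W) (high W) s) (containing-⊕ (low W′) (high W′) s)) ⟩
  containing (low W ⊕ high W) s + containing (low W′ ⊕ high W′) s ∎

Balanced : ∀ {v} → ℕ → Weight v → Weight v → Set
Balanced {v} t W₀ W₁ = (s : Subset v) → ∣ s ∣ ≤ t → containing W₀ s ≡ containing W₁ s

balanced-high : ∀ {v t} {W₀ W₁ : Weight (suc v)} →
  Balanced (suc t) W₀ W₁ → Balanced t (high W₀) (high W₁)
balanced-high bal s le = bal (true ∷ s) (s≤s le)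

balanced-merge : ∀ {v t} {W₀ W₁ : Weight (suc v)} →
  Balanced t W₀ W₁ → Balanced t (low W₀ ⊕ high W₀) (low W₁ ⊕ high W₁)
balanced-merge bal s le = bal (false ∷ s) le

balanced-low : ∀ {v t} {W₀ W₁ : Weight (suc v)} →
  Balanced (suc t) W₀ W₁ → Balanced t (low W₀) (low W₁)
balanced-low {t = t} {W₀} {W₁} bal s le =
  +-cancelʳ-≡ (containing (high W₀) s) (containing (low W₀) s) (containing (low W₁) s) (begin
    containing (low W₀) s + containing (high W₀) s ≡⟨ sym (containing-⊕ (low W₀) (high W₀) s) ⟩
    containing (low W₀ ⊕ high W₀) s               ≡⟨ balanced-merge bal s (m≤n⇒m≤1+n le) ⟩
    containing (low W₁ ⊕ high W₁) s               ≡⟨ containing-⊕ (low W₁) (high W₁) s ⟩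
    containing (low W₁) s + containing (high W₁) s ≡⟨ cong (containing (low W₁) s +_) (sym (balanced-high bal s le)) ⟩
    containing (low W₁) s + containing (high W₀) s ∎)

containing-⊕-comm : ∀ {v} (W W′ : Weight v) (s : Subset v) →
  containing (W ⊕ W′) s ≡ containing (W′ ⊕ W) s
containing-⊕-comm W W′ s = begin
  containing (W ⊕ W′) s          ≡⟨ containing-⊕ W W′ s ⟩
  containing W s + containing W′ s ≡⟨ +-comm (containing W s) _ ⟩
  containing W′ s + containing W s ≡⟨ sym (containing-⊕ W′ W s) ⟩
  containing (W′ ⊕ W) s ∎

balanced-shift : ∀ {v} t (W₀ W₁ : Weight v) → Balanced t W₀ W₁ →
  (w : Subset v) → Balanced t (W₀ ↑ w) (W₁ ↑ w)
balanced-shift {zero} t W₀ W₁ bal [] [] le = bal [] le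
balanced-shift {suc v} zero W₀ W₁ bal w (true ∷ s) ()
balanced-shift {suc v} (suc t) W₀ W₁ bal (false ∷ w) (true ∷ s) (s≤s le) =
  balanced-shift t (high W₀) (high W₁) (balanced-high bal) w s le
balanced-shift {suc v} (suc t) W₀ W₁ bal (true ∷ w) (true ∷ s) (s≤s le) =
  balanced-shift t (low W₀) (low W₁) (balanced-low bal) w s le
balanced-shift {suc v} t W₀ W₁ bal (false ∷ w) (false ∷ s) le =
  balanced-shift t (low W₀ ⊕ high W₀) (low W₁ ⊕ high W₁) (balanced-merge bal) w s le
balanced-shift {suc v} t W₀ W₁ bal (true ∷ w) (false ∷ s) le = begin
  containing ((high W₀ ↑ w) ⊕ (low W₀ ↑ w)) s ≡⟨ containing-⊕-comm (high W₀ ↑ w) _ s ⟩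
  containing ((low W₀ ⊕ high W₀) ↑ w) s
    ≡⟨ balanced-shift t (low W₀ ⊕ high W₀) (low W₁ ⊕ high W₁) (balanced-merge bal) w s le ⟩
  containing ((low W₁ ⊕ high W₁) ↑ w) s       ≡⟨ containing-⊕-comm (low W₁ ↑ w) _ s ⟩
  containing ((high W₁ ↑ w) ⊕ (low W₁ ↑ w)) s ∎

-- The list-based count of Defs is the weight count of the indicator: the
-- enumeration of 2^(1+v) splits into its two halves, and on each half the filter
-- agrees (as a Boolean test) with the one for the restricted family and s minus
-- its first point; when s ∋ 1 the lower half contributes nothing.
countContaining≡containing : ∀ {v} (F : Family v) (s : Subset v) →
  countContaining F s ≡ containing (indicator F) s
countContaining≡containing {zero} F [] with F []
... | true  = refl
... | false = refl
countContaining≡containing {suc v} F s = begin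
  length (filter P? (map (false ∷_) xs ++ map (true ∷_) xs))
    ≡⟨ cong length (filter-++ P? (map (false ∷_) xs) (map (true ∷_) xs)) ⟩
  length (filter P? (map (false ∷_) xs) ++ filter P? (map (true ∷_) xs))
    ≡⟨ length-++ (filter P? (map (false ∷_) xs)) ⟩
  length (filter P? (map (false ∷_) xs)) + length (filter P? (map (true ∷_) xs))
    ≡⟨ cong₂ _+_ (length-filter-map P? (false ∷_) xs) (length-filter-map P? (true ∷_) xs) ⟩
  length (filter (λ x → P? (false ∷ x)) xs) + length (filter (λ x → P? (true ∷ x)) xs)
    ≡⟨ halves s ⟩
  containing (indicator F) s ∎
  where
  xs : List (Subset v)
  xs = allSubsets v
  P? : Decidable (λ x → T (F x) × s ⊆ x)
  P? = λ x → T? (F x) ×-dec (s ⊆? x)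
  halves : (s : Subset (suc v)) →
    length (filter (λ x → T? (F (false ∷ x)) ×-dec (s ⊆? (false ∷ x))) xs)
      + length (filter (λ x → T? (F (true ∷ x)) ×-dec (s ⊆? (true ∷ x))) xs)
    ≡ containing (indicator F) s
  halves (true ∷ s) = cong₂ _+_
    (length-filter-none _ (λ x → ∧-zeroʳ (F (false ∷ x))) xs)
    (trans (length-filter-does _ _ (λ _ → refl) xs) (countContaining≡containing (λ x → F (true ∷ x)) s))
  halves (false ∷ s) = begin
    _ ≡⟨ cong₂ _+_ (trans (length-filter-does _ _ (λ _ → refl) xs) (countContaining≡containing (λ x → F (false ∷ x)) s))
                   (trans (length-filter-does _ _ (λ _ → refl) xs) (countContaining≡containing (λ x → F (true ∷ x)) s)) ⟩
    containing (low (indicator F)) s + containing (high (indicator F)) s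
      ≡⟨ sym (containing-⊕ (low (indicator F)) (high (indicator F)) s) ⟩
    containing (indicator F) (false ∷ s) ∎

corollary1 : (v t : ℕ) (T₀ T₁ : Family v) → IsTrade t T₀ T₁ →
    (w : Subset v) → IsTrade t (T₀ +ᶠ w) (T₁ +ᶠ w)
corollary1 v t T₀ T₁ (disjoint , trade) w = (λ x → disjoint (x +ᵥ w)) , λ s le → begin
  countContaining (T₀ +ᶠ w) s      ≡⟨ countContaining≡containing (T₀ +ᶠ w) s ⟩
  containing (indicator T₀ ↑ w) s  ≡⟨ balanced-shift t (indicator T₀) (indicator T₁) weights-balanced w s le ⟩
  containing (indicator T₁ ↑ w) s  ≡⟨ sym (countContaining≡containing (T₁ +ᶠ w) s) ⟩
  countContaining (T₁ +ᶠ w) s ∎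
  where
  weights-balanced : Balanced t (indicator T₀) (indicator T₁)
  weights-balanced s le = begin
    containing (indicator T₀) s ≡⟨ sym (countContaining≡containing T₀ s) ⟩
    countContaining T₀ s        ≡⟨ trade s le ⟩
    countContaining T₁ s        ≡⟨ countContaining≡containing T₁ s ⟩
    containing (indicator T₁) s ∎
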